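{- For all positive integers $n,r,s$ with $1\le s\le\frac r2$, $$f(n,r,s)\ge n-n\prod_{i=1}^{s}\left(1-\frac{i}{r-i+1}\right)\ge\left(1-e^{ -\frac{s(s+1)}{2r}}\right)n.$$
   Context: An $r$-edge colouring of $K_n$ assigns to each edge one of $r$ colours. $f(n,r,s)$ denotes the largest integer $m$ such that in every $r$-edge colouring of $K_n$ there exist a set $S$ of at most $s$ colours and a connected subgraph of $K_n$ on at least $m$ vertices all of whose edges have colours in $S$. -}

module Defs where

open import Data.Nat using (ℕ; zero; suc; _*_; _∸_; _≤_)
open import Data.Fin using (Fin)
open import Data.Fin.Subset using (Subset; _∈_; ∣_∣)
open import Data.Integer using (+_)
open import Data.Rational using (ℚ; _/_; 0ℚ; 1ℚ)
  renaming (_*_ to _*ℚ_; _-_ to _-ℚ_; _+_ to _+ℚ_; _≤_ to _≤ℚ_)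
open import Data.Product using (Σ; _×_)
open import Relation.Binary.PropositionalEquality using (_≡_; _≢_)

-- An r-edge colouring of K_n: a symmetric assignment of a colour in Fin r to
-- each pair of vertices (values on the diagonal u = u are irrelevant, since
-- K_n has no loops and adjacency below requires u ≢ v).
record Colouring (n r : ℕ) : Set where
  field
    colour : Fin n → Fin n → Fin r
    sym    : ∀ u v → colour u v ≡ colour v u
open Colouring public

EdgeIn : {n r : ℕ} → Colouring n r → Subset r → Fin n → Fin n → Set
EdgeIn c S u v = (u ≢ v) × (colour c u v ∈ S)

data Walk {n r : ℕ} (c : Colouring n r) (S : Subset r) (U : Subset n)
          : Fin n → Fin n → Set where
  here : ∀ {u} → u ∈ U → Walk c S U u u
  step : ∀ {u w v} → u ∈ U → EdgeIn c S u w → Walk c S U w v → Walk c S U u v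

Connected : {n r : ℕ} → Colouring n r → Subset r → Subset n → Set
Connected c S U = ∀ u v → u ∈ U → v ∈ U → Walk c S U u v

Good : ℕ → ℕ → ℕ → ℕ → Set
Good n r s m =
  (c : Colouring n r) →
  Σ (Subset r) λ S → Σ (Subset n) λ U →
    (∣ S ∣ ≤ s) × (m ≤ ∣ U ∣) × Connected c S U

-- m = f(n,r,s): the largest integer m with the property Good n r s m.
IsF : ℕ → ℕ → ℕ → ℕ → Set
IsF n r s m = Good n r s m × (∀ m′ → Good n r s m′ → m′ ≤ m)

prodTerm : ℕ → ℕ → ℚ
prodTerm r zero    = 1ℚ
prodTerm r (suc k) = prodTerm r k *ℚ (1ℚ -ℚ ((+ suc k) / suc (r ∸ suc k)))

-- s(s+1)/(2r)   (r = 0 never occurs under the hypotheses; set to 0 there)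
expo : ℕ → ℕ → ℚ
expo s zero    = 0ℚ
expo s (suc r) = (+ (s * suc s)) / (2 * suc r)

expTerm : ℚ → ℕ → ℚ
expTerm x zero    = 1ℚ
expTerm x (suc k) = expTerm x k *ℚ x *ℚ ((+ 1) / suc k)

-- partial sum Σ_{k=0}^{N} x^k/k!  ;  e^x is the supremum of these over N
expPartial : ℚ → ℕ → ℚ
expPartial x zero    = 1ℚ
expPartial x (suc N) = expPartial x N +ℚ expTerm x (suc N)

toℚ : ℕ → ℚ
toℚ k = (+ k) / 1

-- Round i turns a connected set U spanned by at most i colours into one spanned by at most
-- i + 1 colours. While some vertex w outside U is joined to U in a colour already used, or sees
-- at most i colours on U, it is absorbed (in the second case the colours w sees on U become the
-- new colour set, U ∪ {w} being a star at w). Otherwise each of the n - |U| outside vertices sees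
-- at least i + 1 colours on U, all of them unused; double counting over the r - i unused colours
-- yields one colour joining at least a fraction (i + 1)/(r - i) of them to U, and adding it leaves
-- at most (n - |U|)(1 - (i + 1)/(r - i)) vertices outside. After s rounds at most
-- n ∏_{i=1}^{s} (1 - i/(r - i + 1)) vertices are missed.
--
-- For the exponential bound each factor is at most 1 - i/r, and (1 - a) e^(y + a) ≤ e^y already
-- holds for the partial sums of the exponential series; chaining it over i = 1, …, s gives
-- ∏ (1 - i/r) · Σ_{k ≤ N} x^k/k! ≤ 1 at x = Σ i/r = s(s + 1)/(2r).

module Submission where

open import Defs hiding (sym)

module FiniteSets where

  open import Data.Nat as ℕ using (ℕ; zero; suc; _+_; _*_; _≤_; z≤n; s≤s)
  import Data.Nat.Properties as ℕ
  open import Data.Nat.Solver using (module +-*-Solver)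
  open import Data.Bool using (true; false; if_then_else_)
  open import Data.Fin using (Fin; zero; suc)
  import Data.Fin.Properties as Fin
  open import Data.Fin.Subset using (Subset; inside; outside; _∈_; _∉_; _⊆_; _∪_; ⁅_⁆; ∣_∣)
  open import Data.Fin.Subset.Properties using (_∈?_; ∣p∣≤n; ∣⁅x⁆∣≡1; x∈⁅y⁆⇒x≡y)
  open import Data.Vec using ([]; _∷_; lookup; tabulate; here; there)
  open import Data.Vec.Properties using (lookup∘tabulate; []=⇒lookup; lookup⇒[]=)
  open import Data.Product using (∃; _×_; _,_)
  open import Function using (_∘_)
  open import Level using (Level)
  open import Relation.Nullary using (yes; no; does; _×-dec_)
  open import Relation.Nullary.Negation using (contradiction)
  open import Relation.Nullary.Decidable using (dec-true)
  open import Relation.Unary using (Pred; Decidable)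
  open import Relation.Binary.PropositionalEquality
    using (_≡_; refl; sym; trans; cong; cong₂; subst; module ≡-Reasoning)

  private
    variable
      k : ℕ
      ℓ : Level

  ∑ : (Fin k → ℕ) → ℕ
  ∑ {zero}  f = 0
  ∑ {suc k} f = f zero + ∑ (f ∘ suc)

  ∑-cong : {f g : Fin k → ℕ} → (∀ x → f x ≡ g x) → ∑ f ≡ ∑ g
  ∑-cong {zero}  f≗g = refl
  ∑-cong {suc k} f≗g = cong₂ _+_ (f≗g zero) (∑-cong (f≗g ∘ suc))

  ∑-mono-≤ : {f g : Fin k → ℕ} → (∀ x → f x ≤ g x) → ∑ f ≤ ∑ g
  ∑-mono-≤ {zero}  f≤g = z≤n
  ∑-mono-≤ {suc k} f≤g = ℕ.+-mono-≤ (f≤g zero) (∑-mono-≤ (f≤g ∘ suc))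

  ∑-+ : (f g : Fin k → ℕ) → ∑ (λ x → f x + g x) ≡ ∑ f + ∑ g
  ∑-+ {zero}  f g = refl
  ∑-+ {suc k} f g rewrite ∑-+ (f ∘ suc) (g ∘ suc) =
    solve 4 (λ a b c d → (a :+ b) :+ (c :+ d) := (a :+ c) :+ (b :+ d)) refl (f zero) (g zero) (∑ (f ∘ suc)) (∑ (g ∘ suc))
    where open +-*-Solver

  ∑-*ˡ : ∀ m (f : Fin k → ℕ) → ∑ (λ x → m * f x) ≡ m * ∑ f
  ∑-*ˡ {zero}  m f = sym (ℕ.*-zeroʳ m)
  ∑-*ˡ {suc k} m f rewrite ∑-*ˡ m (f ∘ suc) = sym (ℕ.*-distribˡ-+ m (f zero) (∑ (f ∘ suc)))

  ∑-0 : ∑ {k} (λ _ → 0) ≡ 0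
  ∑-0 {zero}  = refl
  ∑-0 {suc k} = ∑-0 {k}

  ∑-comm : ∀ {l} (f : Fin k → Fin l → ℕ) → ∑ (λ i → ∑ (f i)) ≡ ∑ (λ j → ∑ (λ i → f i j))
  ∑-comm {zero}  {l} f = sym (∑-0 {l})
  ∑-comm {suc k} {l} f = begin
    ∑ (f zero) + ∑ (λ i → ∑ (f (suc i)))             ≡⟨ cong (∑ (f zero) +_) (∑-comm (f ∘ suc)) ⟩
    ∑ (f zero) + ∑ (λ j → ∑ (λ i → f (suc i) j))     ≡⟨ ∑-+ (f zero) (λ j → ∑ (λ i → f (suc i) j)) ⟨
    ∑ (λ j → f zero j + ∑ (λ i → f (suc i) j))       ∎
    where open ≡-Reasoning

  𝟙 : Subset k → Fin k → ℕ
  𝟙 p x = if lookup p x then 1 else 0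

  𝟙-∈ : ∀ {p : Subset k} {x} → x ∈ p → 𝟙 p x ≡ 1
  𝟙-∈ x∈p rewrite []=⇒lookup x∈p = refl

  𝟙-∉ : ∀ {p : Subset k} {x} → x ∉ p → 𝟙 p x ≡ 0
  𝟙-∉ {p = p} {x} x∉p with lookup p x in eq
  ... | true  = contradiction (lookup⇒[]= x p eq) x∉p
  ... | false = refl

  ∣p∣≡∑𝟙 : (p : Subset k) → ∣ p ∣ ≡ ∑ (𝟙 p)
  ∣p∣≡∑𝟙 []           = refl
  ∣p∣≡∑𝟙 (inside ∷ p)  = cong suc (∣p∣≡∑𝟙 p)
  ∣p∣≡∑𝟙 (outside ∷ p) = ∣p∣≡∑𝟙 p

  ∣p∪q∣≤∣p∣+∣q∣ : (p q : Subset k) → ∣ p ∪ q ∣ ≤ ∣ p ∣ + ∣ q ∣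
  ∣p∪q∣≤∣p∣+∣q∣ []            []            = z≤n
  ∣p∪q∣≤∣p∣+∣q∣ (outside ∷ p) (outside ∷ q) = ∣p∪q∣≤∣p∣+∣q∣ p q
  ∣p∪q∣≤∣p∣+∣q∣ (inside ∷ p)  (outside ∷ q) = s≤s (∣p∪q∣≤∣p∣+∣q∣ p q)
  ∣p∪q∣≤∣p∣+∣q∣ (outside ∷ p) (inside ∷ q)  = ℕ.≤-trans (s≤s (∣p∪q∣≤∣p∣+∣q∣ p q)) (ℕ.≤-reflexive (sym (ℕ.+-suc ∣ p ∣ ∣ q ∣)))
  ∣p∪q∣≤∣p∣+∣q∣ (inside ∷ p)  (inside ∷ q)  = s≤s (ℕ.≤-trans (∣p∪q∣≤∣p∣+∣q∣ p q) (ℕ.+-monoʳ-≤ ∣ p ∣ (ℕ.n≤1+n ∣ q ∣)))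

  ∣p∪q∣≡∣p∣+∣q∣ : (p q : Subset k) → (∀ {x} → x ∈ p → x ∉ q) → ∣ p ∪ q ∣ ≡ ∣ p ∣ + ∣ q ∣
  ∣p∪q∣≡∣p∣+∣q∣ []            []            _    = refl
  ∣p∪q∣≡∣p∣+∣q∣ (outside ∷ p) (outside ∷ q) disj = ∣p∪q∣≡∣p∣+∣q∣ p q (λ x∈p x∈q → disj (there x∈p) (there x∈q))
  ∣p∪q∣≡∣p∣+∣q∣ (inside ∷ p)  (outside ∷ q) disj = cong suc (∣p∪q∣≡∣p∣+∣q∣ p q (λ x∈p x∈q → disj (there x∈p) (there x∈q)))
  ∣p∪q∣≡∣p∣+∣q∣ (outside ∷ p) (inside ∷ q)  disj =
    trans (cong suc (∣p∪q∣≡∣p∣+∣q∣ p q (λ x∈p x∈q → disj (there x∈p) (there x∈q)))) (sym (ℕ.+-suc ∣ p ∣ ∣ q ∣))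
  ∣p∪q∣≡∣p∣+∣q∣ (inside ∷ p)  (inside ∷ q)  disj = contradiction here (disj here)

  ∣p∪⁅x⁆∣≡1+∣p∣ : ∀ {p : Subset k} {x} → x ∉ p → ∣ p ∪ ⁅ x ⁆ ∣ ≡ suc ∣ p ∣
  ∣p∪⁅x⁆∣≡1+∣p∣ {p = p} {x} x∉p = begin
    ∣ p ∪ ⁅ x ⁆ ∣     ≡⟨ ∣p∪q∣≡∣p∣+∣q∣ p ⁅ x ⁆ (λ y∈p y∈⁅x⁆ → x∉p (subst (_∈ p) (x∈⁅y⁆⇒x≡y x y∈⁅x⁆) y∈p)) ⟩
    ∣ p ∣ + ∣ ⁅ x ⁆ ∣ ≡⟨ cong (∣ p ∣ +_) (∣⁅x⁆∣≡1 x) ⟩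
    ∣ p ∣ + 1         ≡⟨ ℕ.+-comm ∣ p ∣ 1 ⟩
    suc ∣ p ∣         ∎
    where open ≡-Reasoning

  ∣p∪⁅x⁆∣≤1+∣p∣ : ∀ (p : Subset k) x → ∣ p ∪ ⁅ x ⁆ ∣ ≤ suc ∣ p ∣
  ∣p∪⁅x⁆∣≤1+∣p∣ p x = ℕ.≤-trans (∣p∪q∣≤∣p∣+∣q∣ p ⁅ x ⁆) (ℕ.≤-reflexive (trans (cong (∣ p ∣ +_) (∣⁅x⁆∣≡1 x)) (ℕ.+-comm ∣ p ∣ 1)))

  extend-to-size : ∀ (S : Subset k) {m} → ∣ S ∣ ≤ m → m ≤ k → ∃ λ S′ → S ⊆ S′ × ∣ S′ ∣ ≡ m
  extend-to-size []           {zero} _ _ = [] , (λ ()) , refl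
  extend-to-size (inside ∷ S) {suc m} (s≤s ∣S∣≤m) (s≤s m≤k) with extend-to-size S ∣S∣≤m m≤k
  ... | S′ , S⊆S′ , ∣S′∣≡m = inside ∷ S′ , extended , cong suc ∣S′∣≡m
    where
    extended : inside ∷ S ⊆ inside ∷ S′
    extended here        = here
    extended (there x∈S) = there (S⊆S′ x∈S)
  extend-to-size {suc k} (outside ∷ S) {m} ∣S∣≤m m≤1+k with m ℕ.≤? k
  ... | yes m≤k with extend-to-size S ∣S∣≤m m≤k
  ...   | S′ , S⊆S′ , ∣S′∣≡m = outside ∷ S′ , extended , ∣S′∣≡m
    where
    extended : outside ∷ S ⊆ outside ∷ S′
    extended (there x∈S) = there (S⊆S′ x∈S)
  extend-to-size {suc k} (outside ∷ S) {m} ∣S∣≤m m≤1+k | no m≰k with extend-to-size S (∣p∣≤n S) ℕ.≤-refl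
  ...   | S′ , S⊆S′ , ∣S′∣≡k = inside ∷ S′ , extended , trans (cong suc ∣S′∣≡k) (ℕ.≤-antisym (ℕ.≰⇒> m≰k) m≤1+k)
    where
    extended : outside ∷ S ⊆ inside ∷ S′
    extended (there x∈S) = there (S⊆S′ x∈S)

  ⟦_⟧ : {P : Pred (Fin k) ℓ} → Decidable P → Subset k
  ⟦ P? ⟧ = tabulate (does ∘ P?)

  ∈⟦⟧⁺ : {P : Pred (Fin k) ℓ} (P? : Decidable P) {x : Fin k} → P x → x ∈ ⟦ P? ⟧
  ∈⟦⟧⁺ P? {x} Px = lookup⇒[]= x _ (trans (lookup∘tabulate (does ∘ P?) x) (dec-true (P? x) Px))

  ∈⟦⟧⁻ : {P : Pred (Fin k) ℓ} (P? : Decidable P) {x : Fin k} → x ∈ ⟦ P? ⟧ → P x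
  ∈⟦⟧⁻ P? {x} x∈ with P? x | trans (sym (lookup∘tabulate (does ∘ P?) x)) ([]=⇒lookup x∈)
  ... | yes Px | _  = Px
  ... | no _   | ()

  pigeonhole : (B : Subset k) (g : Fin k → ℕ) {t : ℕ} → 1 ≤ ∣ B ∣ → t ≤ ∑ (λ y → 𝟙 B y * g y) →
               ∃ λ y → y ∈ B × t ≤ g y * ∣ B ∣
  pigeonhole B g {t} 1≤∣B∣ t≤G with Fin.any? (λ y → y ∈? B ×-dec t ℕ.≤? g y * ∣ B ∣)
  ... | yes found = found
  ... | no none   = contradiction (ℕ.≤-trans too-big too-small) (ℕ.<-irrefl refl)
    where
    open ℕ.≤-Reasoning
    b = ∣ B ∣
    G = ∑ (λ y → 𝟙 B y * g y)
    below-average : ∀ y → 𝟙 B y * suc (g y * b) ≤ 𝟙 B y * t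
    below-average y with y ∈? B
    ... | yes y∈B rewrite 𝟙-∈ y∈B = ℕ.+-monoˡ-≤ 0 (ℕ.≰⇒> (λ t≤ → none (y , y∈B , t≤)))
    ... | no y∉B  rewrite 𝟙-∉ y∉B = z≤n
    too-small : ∑ (λ y → 𝟙 B y * suc (g y * b)) ≤ t * b
    too-small = begin
      ∑ (λ y → 𝟙 B y * suc (g y * b)) ≤⟨ ∑-mono-≤ below-average ⟩
      ∑ (λ y → 𝟙 B y * t)             ≡⟨ ∑-cong (λ y → ℕ.*-comm (𝟙 B y) t) ⟩
      ∑ (λ y → t * 𝟙 B y)             ≡⟨ ∑-*ˡ t (𝟙 B) ⟩
      t * ∑ (𝟙 B)                     ≡⟨ cong (t *_) (∣p∣≡∑𝟙 B) ⟨
      t * b                           ∎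
    too-big : suc (t * b) ≤ ∑ (λ y → 𝟙 B y * suc (g y * b))
    too-big = begin
      suc (t * b)                                    ≤⟨ ℕ.+-mono-≤ 1≤∣B∣ (ℕ.≤-reflexive (ℕ.*-comm t b)) ⟩
      b + b * t                                      ≤⟨ ℕ.+-monoʳ-≤ b (ℕ.*-monoʳ-≤ b t≤G) ⟩
      b + b * G                                      ≡⟨ ℕ.+-comm b (b * G) ⟩
      b * G + b                                      ≡⟨ cong₂ _+_ (∑-*ˡ b (λ y → 𝟙 B y * g y)) (sym (∣p∣≡∑𝟙 B)) ⟨
      ∑ (λ y → b * (𝟙 B y * g y)) + ∑ (𝟙 B)          ≡⟨ ∑-+ (λ y → b * (𝟙 B y * g y)) (𝟙 B) ⟨
      ∑ (λ y → b * (𝟙 B y * g y) + 𝟙 B y)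
        ≡⟨ ∑-cong (λ y → solve 3 (λ i g b → b :* (i :* g) :+ i := i :* (con 1 :+ g :* b)) refl (𝟙 B y) (g y) b) ⟩
      ∑ (λ y → 𝟙 B y * suc (g y * b))                ∎
      where open +-*-Solver

module Colourings where

  open FiniteSets
  open import Data.Nat as ℕ using (ℕ; zero; suc; _+_; _*_; _∸_; _≤_; z≤n; NonZero)
  import Data.Nat.Properties as ℕ
  open import Data.Nat.Solver using (module +-*-Solver)
  open import Data.Nat.DivMod using (_/_; m*n/n≡m; /-monoˡ-≤)
  open import Data.Fin using (Fin; _≟_)
  import Data.Fin.Properties as Fin
  open import Data.Fin.Subset using (Subset; _∈_; _∉_; _⊆_; _∪_; ⁅_⁆; ∁; ⊥; ∣_∣)
  open import Data.Fin.Subset.Properties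
    using (_∈?_; ∣p∣≤n; ∣⊥∣≡0; x∈⁅x⁆; x∈⁅y⁆⇒x≡y; ∉⊥; p⊆p∪q; ∣p∣≤∣p∪q∣; x∈p∪q⁻; x∈p∪q⁺;
           x∉p⇒x∈∁p; x∈p⇒x∉∁p; ∣∁p∣≡n∸∣p∣)
  open import Data.Product using (Σ; ∃; _×_; _,_; proj₁; proj₂)
  open import Data.Sum using (_⊎_; inj₁; inj₂)
  open import Function using (id; _∘_)
  open import Relation.Nullary using (yes; no; ¬?; _×-dec_; _⊎-dec_)
  open import Relation.Nullary.Negation using (contradiction)
  open import Relation.Unary using (Decidable)
  open import Relation.Binary.PropositionalEquality
    using (_≡_; _≢_; ≢-sym; refl; sym; trans; cong; cong₂; subst)

  [m∸n]*o≤m*[o∸p] : ∀ {m n o p} → p * m ≤ n * o → (m ∸ n) * o ≤ m * (o ∸ p)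
  [m∸n]*o≤m*[o∸p] {m} {n} {o} {p} pm≤no = begin
    (m ∸ n) * o   ≡⟨ ℕ.*-distribʳ-∸ o m n ⟩
    m * o ∸ n * o ≤⟨ ℕ.∸-monoʳ-≤ (m * o) pm≤no ⟩
    m * o ∸ p * m ≡⟨ cong (m * o ∸_) (ℕ.*-comm p m) ⟩
    m * o ∸ m * p ≡⟨ ℕ.*-distribˡ-∸ m o p ⟨
    m * (o ∸ p)   ∎
    where open ℕ.≤-Reasoning

  missing-absorb : ∀ {n k} {U : Subset k} {w fuel} → w ∉ U → n ∸ ∣ U ∣ ≤ suc fuel → n ∸ ∣ U ∪ ⁅ w ⁆ ∣ ≤ fuel
  missing-absorb {n} {U = U} {w} {fuel} w∉U missing≤ = begin
    n ∸ ∣ U ∪ ⁅ w ⁆ ∣    ≡⟨ cong (n ∸_) (∣p∪⁅x⁆∣≡1+∣p∣ w∉U) ⟩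
    n ∸ suc ∣ U ∣        ≡⟨ ℕ.pred[m∸n]≡m∸[1+n] n ∣ U ∣ ⟨
    ℕ.pred (n ∸ ∣ U ∣)   ≤⟨ ℕ.pred-mono-≤ missing≤ ⟩
    fuel                 ∎
    where open ℕ.≤-Reasoning

  -- prodTerm r k = prodNum r k / prodDen r k
  prodDen : ℕ → ℕ → ℕ
  prodDen r zero    = 1
  prodDen r (suc k) = prodDen r k * suc (r ∸ suc k)

  prodNum : ℕ → ℕ → ℕ
  prodNum r zero    = 1
  prodNum r (suc k) = prodNum r k * (suc (r ∸ suc k) ∸ suc k)

  prodDen-nonZero : ∀ r k → NonZero (prodDen r k)
  prodDen-nonZero r zero    = _
  prodDen-nonZero r (suc k) = ℕ.m*n≢0 (prodDen r k) (suc (r ∸ suc k)) {{prodDen-nonZero r k}}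

  ratio-≤-trans : ∀ {a b c d e D N} → a * d ≤ b * e → b * D ≤ c * N → a * (D * d) ≤ c * (N * e)
  ratio-≤-trans {a} {b} {c} {d} {e} {D} {N} ad≤be bD≤cN = begin
    a * (D * d)   ≡⟨ solve 3 (λ a D d → a :* (D :* d) := (a :* d) :* D) refl a D d ⟩
    (a * d) * D   ≤⟨ ℕ.*-monoˡ-≤ D ad≤be ⟩
    (b * e) * D   ≡⟨ solve 3 (λ b e D → (b :* e) :* D := (b :* D) :* e) refl b e D ⟩
    (b * D) * e   ≤⟨ ℕ.*-monoˡ-≤ e bD≤cN ⟩
    (c * N) * e   ≡⟨ ℕ.*-assoc c N e ⟩
    c * (N * e)   ∎
    where
    open ℕ.≤-Reasoning
    open +-*-Solver

  n∸⌊nN/D⌋≤ : ∀ {n u N} D .{{_ : NonZero D}} → u ≤ n → (n ∸ u) * D ≤ n * N → n ∸ (n * N) / D ≤ u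
  n∸⌊nN/D⌋≤ {n} {u} {N} D u≤n bound = begin
    n ∸ (n * N) / D         ≤⟨ ℕ.∸-monoʳ-≤ n (ℕ.≤-trans (ℕ.≤-reflexive (sym (m*n/n≡m (n ∸ u) D))) (/-monoˡ-≤ D bound)) ⟩
    n ∸ (n ∸ u)             ≡⟨ ℕ.m∸[m∸n]≡n u≤n ⟩
    u                       ∎
    where open ℕ.≤-Reasoning

  module _ {n r : ℕ} (c : Colouring n r) where

    Walk-mono : ∀ {S S′ U U′ u v} → S ⊆ S′ → U ⊆ U′ → Walk c S U u v → Walk c S′ U′ u v
    Walk-mono S⊆S′ U⊆U′ (here u∈U)              = here (U⊆U′ u∈U)
    Walk-mono S⊆S′ U⊆U′ (step u∈U (u≢w , cS) p) = step (U⊆U′ u∈U) (u≢w , S⊆S′ cS) (Walk-mono S⊆S′ U⊆U′ p)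

    _++ʷ_ : ∀ {S U u v w} → Walk c S U u v → Walk c S U v w → Walk c S U u w
    here _     ++ʷ q = q
    step u∈U e p ++ʷ q = step u∈U e (p ++ʷ q)

    EdgeIn-sym : ∀ {S u v} → EdgeIn c S u v → EdgeIn c S v u
    EdgeIn-sym {S} {u} {v} (u≢v , cS) = ≢-sym u≢v , subst (_∈ S) (Colouring.sym c u v) cS

    edge-walk : ∀ {S U u v} → u ∈ U → v ∈ U → EdgeIn c S u v → Walk c S U u v
    edge-walk u∈U v∈U e = step u∈U e (here v∈U)

    Connected-mono : ∀ {S S′ U} → S ⊆ S′ → Connected c S U → Connected c S′ U
    Connected-mono S⊆S′ conn u v u∈U v∈U = Walk-mono S⊆S′ id (conn u v u∈U v∈U)

    connected-∅ : ∀ {S} → Connected c S ⊥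
    connected-∅ u v u∈⊥ = contradiction u∈⊥ ∉⊥

    connected-attach : ∀ {S S′ U U′} → Connected c S U → S ⊆ S′ → U ⊆ U′ →
      (∀ {x} → x ∈ U′ → x ∈ U ⊎ ∃ λ u → u ∈ U × EdgeIn c S′ x u) → Connected c S′ U′
    connected-attach {S′ = S′} {U} {U′} conn S⊆S′ U⊆U′ attached u v u∈U′ v∈U′ =
      let (a , a∈U , u⇝a , _) = to-core u∈U′
          (b , b∈U , _ , b⇝v) = to-core v∈U′
      in  u⇝a ++ʷ (Walk-mono S⊆S′ U⊆U′ (conn a b a∈U b∈U) ++ʷ b⇝v)
      where
      to-core : ∀ {x} → x ∈ U′ → ∃ λ a → a ∈ U × Walk c S′ U′ x a × Walk c S′ U′ a x
      to-core {x} x∈U′ with attached x∈U′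
      ... | inj₁ x∈U = x , x∈U , here x∈U′ , here x∈U′
      ... | inj₂ (a , a∈U , e) = a , a∈U , edge-walk x∈U′ (U⊆U′ a∈U) e , edge-walk (U⊆U′ a∈U) x∈U′ (EdgeIn-sym e)

    connected-star : ∀ {S U h} → h ∈ U → (∀ {x} → x ∈ U → x ≢ h → EdgeIn c S x h) → Connected c S U
    connected-star {S} {U} {h} h∈U spoke u v u∈U v∈U = to-hub u∈U ++ʷ from-hub v∈U
      where
      to-hub : ∀ {x} → x ∈ U → Walk c S U x h
      to-hub {x} x∈U with x ≟ h
      ... | yes refl = here x∈U
      ... | no x≢h   = edge-walk x∈U h∈U (spoke x∈U x≢h)
      from-hub : ∀ {x} → x ∈ U → Walk c S U h x
      from-hub {x} x∈U with x ≟ h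
      ... | yes refl = here x∈U
      ... | no x≢h   = edge-walk h∈U x∈U (EdgeIn-sym (spoke x∈U x≢h))

    Joins : Subset n → Fin n → Fin r → Set
    Joins U w col = ∃ λ u → u ∈ U × colour c w u ≡ col

    joins? : ∀ U w → Decidable (Joins U w)
    joins? U w col = Fin.any? (λ u → u ∈? U ×-dec colour c w u ≟ col)

    coloursTo : Subset n → Fin n → Subset r
    coloursTo U w = ⟦ joins? U w ⟧

    JoinedBy : Subset n → Fin r → Fin n → Set
    JoinedBy U col w = w ∉ U × Joins U w col

    joinedBy? : ∀ U col → Decidable (JoinedBy U col)
    joinedBy? U col w = ¬? (w ∈? U) ×-dec joins? U w col

    joinedBy : Subset n → Fin r → Subset n
    joinedBy U col = ⟦ joinedBy? U col ⟧

    joined-edge : ∀ {S U w col} → w ∉ U → col ∈ S → Joins U w col → ∃ λ u → u ∈ U × EdgeIn c S w u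
    joined-edge {S} w∉U col∈S (u , u∈U , wu≡col) =
      u , u∈U , (λ w≡u → w∉U (subst (_∈ _) (sym w≡u) u∈U)) , subst (_∈ S) (sym wu≡col) col∈S

    absorb-joined : ∀ {S U w col} → Connected c S U → w ∉ U → col ∈ S → Joins U w col → Connected c S (U ∪ ⁅ w ⁆)
    absorb-joined {S} {U} {w} conn w∉U col∈S joins = connected-attach conn id (p⊆p∪q ⁅ w ⁆) attached
      where
      attached : ∀ {x} → x ∈ U ∪ ⁅ w ⁆ → x ∈ U ⊎ ∃ λ u → u ∈ U × EdgeIn c S x u
      attached {x} x∈U⁺ with x∈p∪q⁻ U ⁅ w ⁆ x∈U⁺
      ... | inj₁ x∈U  = inj₁ x∈U
      ... | inj₂ x∈⁅w⁆ rewrite x∈⁅y⁆⇒x≡y w x∈⁅w⁆ = inj₂ (joined-edge w∉U col∈S joins)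

    -- In K_n the vertex w is adjacent to all of U, so U ∪ {w} is a star centred at w.
    absorb-star : ∀ {U w} → w ∉ U → Connected c (coloursTo U w) (U ∪ ⁅ w ⁆)
    absorb-star {U} {w} w∉U = connected-star (x∈p∪q⁺ (inj₂ (x∈⁅x⁆ w))) spoke
      where
      spoke : ∀ {x} → x ∈ U ∪ ⁅ w ⁆ → x ≢ w → EdgeIn c (coloursTo U w) x w
      spoke {x} x∈U⁺ x≢w with x∈p∪q⁻ U ⁅ w ⁆ x∈U⁺
      ... | inj₁ x∈U   = x≢w , ∈⟦⟧⁺ (joins? U w) (x , x∈U , Colouring.sym c w x)
      ... | inj₂ x∈⁅w⁆ = contradiction (x∈⁅y⁆⇒x≡y w x∈⁅w⁆) x≢w

    absorb-colour : ∀ {S U} col → Connected c S U → Connected c (S ∪ ⁅ col ⁆) (U ∪ joinedBy U col)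
    absorb-colour {S} {U} col conn = connected-attach conn (p⊆p∪q ⁅ col ⁆) (p⊆p∪q (joinedBy U col)) attached
      where
      attached : ∀ {x} → x ∈ U ∪ joinedBy U col → x ∈ U ⊎ ∃ λ u → u ∈ U × EdgeIn c (S ∪ ⁅ col ⁆) x u
      attached {x} x∈U⁺ with x∈p∪q⁻ U (joinedBy U col) x∈U⁺
      ... | inj₁ x∈U = inj₁ x∈U
      ... | inj₂ x∈J with ∈⟦⟧⁻ (joinedBy? U col) x∈J
      ...   | x∉U , joins = inj₂ (joined-edge x∉U (x∈p∪q⁺ (inj₂ (x∈⁅x⁆ col))) joins)

    -- Double counting the pairs (w, col) with w ∉ U, col ∉ S and col a colour from w to U.
    ∑-∣joinedBy∣-≥ : ∀ {S U d} → (∀ {w} → w ∉ U → d ≤ ∣ coloursTo U w ∣ × coloursTo U w ⊆ ∁ S) →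
                     d * ∣ ∁ U ∣ ≤ ∑ (λ col → 𝟙 (∁ S) col * ∣ joinedBy U col ∣)
    ∑-∣joinedBy∣-≥ {S} {U} {d} rich = begin
      d * ∣ ∁ U ∣                                        ≡⟨ cong (d *_) (∣p∣≡∑𝟙 (∁ U)) ⟩
      d * ∑ (𝟙 (∁ U))                                    ≡⟨ ∑-*ˡ d (𝟙 (∁ U)) ⟨
      ∑ (λ w → d * 𝟙 (∁ U) w)                            ≤⟨ ∑-mono-≤ per-vertex ⟩
      ∑ (λ w → ∑ (λ col → 𝟙 (∁ S) col * 𝟙 (J col) w))    ≡⟨ ∑-comm (λ w col → 𝟙 (∁ S) col * 𝟙 (J col) w) ⟩
      ∑ (λ col → ∑ (λ w → 𝟙 (∁ S) col * 𝟙 (J col) w))    ≡⟨ ∑-cong (λ col → trans (∑-*ˡ (𝟙 (∁ S) col) (𝟙 (J col)))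
                                                                                (cong (𝟙 (∁ S) col *_) (sym (∣p∣≡∑𝟙 (J col))))) ⟩
      ∑ (λ col → 𝟙 (∁ S) col * ∣ J col ∣)                ∎
      where
      open ℕ.≤-Reasoning
      J = joinedBy U
      per-colour : ∀ {w} → w ∉ U → ∀ col → 𝟙 (coloursTo U w) col ≤ 𝟙 (∁ S) col * 𝟙 (J col) w
      per-colour {w} w∉U col with col ∈? coloursTo U w
      ... | no col∉  rewrite 𝟙-∉ col∉ = z≤n
      ... | yes col∈ rewrite 𝟙-∈ col∈ | 𝟙-∈ (proj₂ (rich w∉U) col∈)
                           | 𝟙-∈ (∈⟦⟧⁺ (joinedBy? U col) (w∉U , ∈⟦⟧⁻ (joins? U w) col∈)) = ℕ.≤-refl
      per-vertex : ∀ w → d * 𝟙 (∁ U) w ≤ ∑ (λ col → 𝟙 (∁ S) col * 𝟙 (J col) w)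
      per-vertex w with w ∈? U
      ... | yes w∈U rewrite 𝟙-∉ (x∈p⇒x∉∁p w∈U) | ℕ.*-zeroʳ d = z≤n
      ... | no w∉U  rewrite 𝟙-∈ (x∉p⇒x∈∁p w∉U) | ℕ.*-identityʳ d = begin
        d                       ≤⟨ proj₁ (rich w∉U) ⟩
        ∣ coloursTo U w ∣       ≡⟨ ∣p∣≡∑𝟙 (coloursTo U w) ⟩
        ∑ (𝟙 (coloursTo U w))   ≤⟨ ∑-mono-≤ (per-colour w∉U) ⟩
        ∑ (λ col → 𝟙 (∁ S) col * 𝟙 (J col) w) ∎

    record Component (k : ℕ) : Set where
      constructor component
      field
        colours     : Subset r
        vertices    : Subset n
        few-colours : ∣ colours ∣ ≤ k
        connected   : Connected c colours vertices
    open Component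

    Growth : ℕ → Subset n → Set
    Growth i U = Σ (Component (suc i)) λ C → (n ∸ ∣ vertices C ∣) * (r ∸ i) ≤ (n ∸ ∣ U ∣) * (r ∸ i ∸ suc i)

    Growth-absorb : ∀ {i} U w → Growth i (U ∪ ⁅ w ⁆) → Growth i U
    Growth-absorb {i} U w (C , shrink) =
      C , ℕ.≤-trans shrink (ℕ.*-monoˡ-≤ (r ∸ i ∸ suc i) (ℕ.∸-monoʳ-≤ n (∣p∣≤∣p∪q∣ U ⁅ w ⁆)))

    close-round : ∀ {i S U} → suc i ≤ r → ∣ S ∣ ≡ i → Connected c S U →
      (∀ {w} → w ∉ U → suc i ≤ ∣ coloursTo U w ∣ × coloursTo U w ⊆ ∁ S) → Growth i U
    close-round {i} {S} {U} i<r ∣S∣≡i conn rich =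
      component (S ∪ ⁅ col ⁆) (U ∪ J) ∣S∪⁅col⁆∣≤1+i (absorb-colour col conn) , shrink
      where
      ∣∁S∣≡r∸i : ∣ ∁ S ∣ ≡ r ∸ i
      ∣∁S∣≡r∸i = trans (∣∁p∣≡n∸∣p∣ S) (cong (r ∸_) ∣S∣≡i)
      popular = pigeonhole (∁ S) (∣_∣ ∘ joinedBy U) (subst (1 ≤_) (sym ∣∁S∣≡r∸i) (ℕ.m<n⇒0<n∸m i<r)) (∑-∣joinedBy∣-≥ rich)
      col = proj₁ popular
      J = joinedBy U col
      many : suc i * ∣ ∁ U ∣ ≤ ∣ J ∣ * ∣ ∁ S ∣
      many = proj₂ (proj₂ popular)
      ∣S∪⁅col⁆∣≤1+i : ∣ S ∪ ⁅ col ⁆ ∣ ≤ suc i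
      ∣S∪⁅col⁆∣≤1+i = subst (λ k → ∣ S ∪ ⁅ col ⁆ ∣ ≤ suc k) ∣S∣≡i (∣p∪⁅x⁆∣≤1+∣p∣ S col)
      ∣U∪J∣ : ∣ U ∪ J ∣ ≡ ∣ U ∣ + ∣ J ∣
      ∣U∪J∣ = ∣p∪q∣≡∣p∣+∣q∣ U J (λ x∈U x∈J → proj₁ (∈⟦⟧⁻ (joinedBy? U col) x∈J) x∈U)
      shrink : (n ∸ ∣ U ∪ J ∣) * (r ∸ i) ≤ (n ∸ ∣ U ∣) * (r ∸ i ∸ suc i)
      shrink = begin
        (n ∸ ∣ U ∪ J ∣) * (r ∸ i)           ≡⟨ cong₂ _*_ missing≡ (sym ∣∁S∣≡r∸i) ⟩
        (∣ ∁ U ∣ ∸ ∣ J ∣) * ∣ ∁ S ∣         ≤⟨ [m∸n]*o≤m*[o∸p] {∣ ∁ U ∣} {∣ J ∣} {∣ ∁ S ∣} {suc i} many ⟩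
        ∣ ∁ U ∣ * (∣ ∁ S ∣ ∸ suc i)         ≡⟨ cong₂ (λ a b → a * (b ∸ suc i)) (∣∁p∣≡n∸∣p∣ U) ∣∁S∣≡r∸i ⟩
        (n ∸ ∣ U ∣) * (r ∸ i ∸ suc i)       ∎
        where
        open ℕ.≤-Reasoning
        missing≡ : n ∸ ∣ U ∪ J ∣ ≡ ∣ ∁ U ∣ ∸ ∣ J ∣
        missing≡ = trans (cong (n ∸_) ∣U∪J∣) (trans (sym (ℕ.∸-+-assoc n ∣ U ∣ ∣ J ∣)) (cong (_∸ ∣ J ∣) (sym (∣∁p∣≡n∸∣p∣ U))))

    Absorbable : ℕ → Subset r → Subset n → Fin n → Set
    Absorbable i S U w = w ∉ U × ((∃ λ col → col ∈ S × Joins U w col) ⊎ ∣ coloursTo U w ∣ ≤ i)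

    absorbable? : ∀ i S U → Decidable (Absorbable i S U)
    absorbable? i S U w =
      ¬? (w ∈? U) ×-dec (Fin.any? (λ col → col ∈? S ×-dec joins? U w col) ⊎-dec ∣ coloursTo U w ∣ ℕ.≤? i)

    grow : ∀ {i} → suc i ≤ r → ∀ fuel (C : Component i) → n ∸ ∣ vertices C ∣ ≤ fuel → Growth i (vertices C)
    grow {i} i<r zero (component S U ∣S∣≤i conn) U-full =
      component S U (ℕ.m≤n⇒m≤1+n ∣S∣≤i) conn , ℕ.≤-trans (ℕ.≤-reflexive (cong (_* (r ∸ i)) (ℕ.n≤0⇒n≡0 U-full))) z≤n
    grow {i} i<r (suc fuel) (component S U ∣S∣≤i conn) missing≤ with extend-to-size S ∣S∣≤i (ℕ.<⇒≤ i<r)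
    ... | S⁺ , S⊆S⁺ , ∣S⁺∣≡i with Fin.any? (absorbable? i S⁺ U)
    ...   | yes (w , w∉U , inj₁ (col , col∈S⁺ , joins)) =
      Growth-absorb U w (grow i<r fuel
        (component S⁺ (U ∪ ⁅ w ⁆) (ℕ.≤-reflexive ∣S⁺∣≡i) (absorb-joined (Connected-mono S⊆S⁺ conn) w∉U col∈S⁺ joins))
        (missing-absorb w∉U missing≤))
    ...   | yes (w , w∉U , inj₂ few) =
      Growth-absorb U w (grow i<r fuel
        (component (coloursTo U w) (U ∪ ⁅ w ⁆) few (absorb-star w∉U))
        (missing-absorb w∉U missing≤))
    ...   | no none = close-round i<r ∣S⁺∣≡i (Connected-mono S⊆S⁺ conn) blocked
      where
      blocked : ∀ {w} → w ∉ U → suc i ≤ ∣ coloursTo U w ∣ × coloursTo U w ⊆ ∁ S⁺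
      blocked {w} w∉U =
        ℕ.≰⇒> (λ few → none (w , w∉U , inj₂ few)) ,
        λ {col} col∈ → x∉p⇒x∈∁p (λ col∈S⁺ → none (w , w∉U , inj₁ (col , col∈S⁺ , ∈⟦⟧⁻ (joins? U w) col∈)))

    iterate : ∀ k → k ≤ r → Σ (Component k) λ C → (n ∸ ∣ vertices C ∣) * prodDen r k ≤ n * prodNum r k
    iterate zero    _   =
      component ⊥ ⊥ (ℕ.≤-reflexive (∣⊥∣≡0 r)) connected-∅ , ℕ.≤-reflexive (cong (λ x → (n ∸ x) * 1) (∣⊥∣≡0 n))
    iterate (suc k) k<r =
      let (C , bound)   = iterate k (ℕ.<⇒≤ k<r)
          (C′ , shrink) = grow k<r n C (ℕ.m∸n≤m n ∣ vertices C ∣)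
          d             = suc (r ∸ suc k)
      in  C′ , ratio-≤-trans {n ∸ ∣ vertices C′ ∣} {n ∸ ∣ vertices C ∣} {n} {d} {d ∸ suc k} {prodDen r k} {prodNum r k}
                 (subst (λ x → (n ∸ ∣ vertices C′ ∣) * x ≤ (n ∸ ∣ vertices C ∣) * (x ∸ suc k)) (ℕ.+-∸-assoc 1 k<r) shrink)
                 bound

  guaranteed : ℕ → ℕ → ℕ → ℕ
  guaranteed n r s = n ∸ _/_ (n * prodNum r s) (prodDen r s) {{prodDen-nonZero r s}}

  good-guaranteed : ∀ n r s → s ≤ r → Good n r s (guaranteed n r s)
  good-guaranteed n r s s≤r c =
    let (component S U ∣S∣≤s conn , bound) = iterate c s s≤r
    in  S , U , ∣S∣≤s , n∸⌊nN/D⌋≤ (prodDen r s) {{prodDen-nonZero r s}} (∣p∣≤n U) bound , conn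

module RationalBounds where

  open Colourings using (prodDen; prodNum; prodDen-nonZero; guaranteed)

  open import Data.Nat as ℕ using (ℕ; zero; suc; _∸_; NonZero)
  import Data.Nat.Properties as ℕ
  open import Data.Nat.DivMod as ℕ using (m/n*n≤m)
  open import Data.Nat.Solver renaming (module +-*-Solver to ℕ-Solver)
  open import Data.Integer as ℤ using (+_)
  import Data.Integer.Properties as ℤ
  open import Data.Integer.Solver renaming (module +-*-Solver to ℤ-Solver)
  open import Data.Rational using (ℚ; _/_; 0ℚ; 1ℚ; _+_; _*_; _-_; -_; _≤_; _<_; toℚᵘ; fromℚᵘ; positive; nonNegative)
  open import Data.Rational.Properties
  open import Data.Rational.Solver renaming (module +-*-Solver to ℚ-Solver)
  open import Data.Rational.Unnormalised as ℚᵘ using (ℚᵘ; mkℚᵘ; *≡*; *≤*; *<*)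
  import Data.Rational.Unnormalised.Properties as ℚᵘ
  open import Relation.Binary.PropositionalEquality

  fromℚᵘ-+ : ∀ p q → fromℚᵘ (p ℚᵘ.+ q) ≡ fromℚᵘ p + fromℚᵘ q
  fromℚᵘ-+ p q = toℚᵘ-injective (begin
    toℚᵘ (fromℚᵘ (p ℚᵘ.+ q))                      ≈⟨ toℚᵘ-fromℚᵘ (p ℚᵘ.+ q) ⟩
    p ℚᵘ.+ q                                       ≈⟨ ℚᵘ.+-cong (toℚᵘ-fromℚᵘ p) (toℚᵘ-fromℚᵘ q) ⟨
    toℚᵘ (fromℚᵘ p) ℚᵘ.+ toℚᵘ (fromℚᵘ q)          ≈⟨ toℚᵘ-homo-+ (fromℚᵘ p) (fromℚᵘ q) ⟨
    toℚᵘ (fromℚᵘ p + fromℚᵘ q)                    ∎)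
    where open ℚᵘ.≃-Reasoning

  fromℚᵘ-* : ∀ p q → fromℚᵘ (p ℚᵘ.* q) ≡ fromℚᵘ p * fromℚᵘ q
  fromℚᵘ-* p q = toℚᵘ-injective (begin
    toℚᵘ (fromℚᵘ (p ℚᵘ.* q))                      ≈⟨ toℚᵘ-fromℚᵘ (p ℚᵘ.* q) ⟩
    p ℚᵘ.* q                                       ≈⟨ ℚᵘ.*-cong (toℚᵘ-fromℚᵘ p) (toℚᵘ-fromℚᵘ q) ⟨
    toℚᵘ (fromℚᵘ p) ℚᵘ.* toℚᵘ (fromℚᵘ q)          ≈⟨ toℚᵘ-homo-* (fromℚᵘ p) (fromℚᵘ q) ⟨
    toℚᵘ (fromℚᵘ p * fromℚᵘ q)                    ∎)
    where open ℚᵘ.≃-Reasoning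

  fromℚᵘ-mono-≤ : ∀ {p q} → p ℚᵘ.≤ q → fromℚᵘ p ≤ fromℚᵘ q
  fromℚᵘ-mono-≤ {p} {q} p≤q = toℚᵘ-cancel-≤
    (ℚᵘ.≤-respˡ-≃ (ℚᵘ.≃-sym (toℚᵘ-fromℚᵘ p)) (ℚᵘ.≤-respʳ-≃ (ℚᵘ.≃-sym (toℚᵘ-fromℚᵘ q)) p≤q))

  ℕ→ℚᵘ : ℕ → ℚᵘ
  ℕ→ℚᵘ a = mkℚᵘ (+ a) 0

  toℚ-+ : ∀ a b → toℚ (a ℕ.+ b) ≡ toℚ a + toℚ b
  toℚ-+ a b = trans (fromℚᵘ-cong {ℕ→ℚᵘ (a ℕ.+ b)} {ℕ→ℚᵘ a ℚᵘ.+ ℕ→ℚᵘ b} (*≡* eq)) (fromℚᵘ-+ (ℕ→ℚᵘ a) (ℕ→ℚᵘ b))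
    where
    open ℤ-Solver
    eq : + (a ℕ.+ b) ℤ.* + 1 ≡ (+ a ℤ.* + 1 ℤ.+ + b ℤ.* + 1) ℤ.* + 1
    eq rewrite ℤ.pos-+ a b = solve 2 (λ x y → (x :+ y) :* con (+ 1) := (x :* con (+ 1) :+ y :* con (+ 1)) :* con (+ 1)) refl (+ a) (+ b)

  toℚ-* : ∀ a b → toℚ (a ℕ.* b) ≡ toℚ a * toℚ b
  toℚ-* a b = trans (fromℚᵘ-cong {ℕ→ℚᵘ (a ℕ.* b)} {ℕ→ℚᵘ a ℚᵘ.* ℕ→ℚᵘ b} (*≡* eq)) (fromℚᵘ-* (ℕ→ℚᵘ a) (ℕ→ℚᵘ b))
    where
    eq : + (a ℕ.* b) ℤ.* + 1 ≡ (+ a ℤ.* + b) ℤ.* + 1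
    eq = cong (ℤ._* + 1) (ℤ.pos-* a b)

  toℚ-mono-≤ : ∀ {a b} → a ℕ.≤ b → toℚ a ≤ toℚ b
  toℚ-mono-≤ {a} {b} a≤b = fromℚᵘ-mono-≤ {ℕ→ℚᵘ a} {ℕ→ℚᵘ b} (*≤* le)
    where
    le : + a ℤ.* + 1 ℤ.≤ + b ℤ.* + 1
    le rewrite ℤ.*-identityʳ (+ a) | ℤ.*-identityʳ (+ b) = ℤ.+≤+ a≤b

  a/d*d≡a : ∀ a d → (+ a / suc d) * toℚ (suc d) ≡ toℚ a
  a/d*d≡a a d = trans (sym (fromℚᵘ-* (mkℚᵘ (+ a) d) (ℕ→ℚᵘ (suc d))))
                      (fromℚᵘ-cong {mkℚᵘ (+ a) d ℚᵘ.* ℕ→ℚᵘ (suc d)} {ℕ→ℚᵘ a} (*≡* eq))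
    where
    open ℤ-Solver
    eq : (+ a ℤ.* + suc d) ℤ.* + 1 ≡ + a ℤ.* + (suc d ℕ.* 1)
    eq rewrite ℕ.*-identityʳ (suc d) = solve 2 (λ x y → (x :* y) :* con (+ 1) := x :* y) refl (+ a) (+ suc d)

  a/d-antimono-≤ : ∀ a {d e} → e ℕ.≤ d → + a / suc d ≤ + a / suc e
  a/d-antimono-≤ a {d} {e} e≤d = fromℚᵘ-mono-≤ {mkℚᵘ (+ a) d} {mkℚᵘ (+ a) e} (*≤* le)
    where
    le : + a ℤ.* + suc e ℤ.≤ + a ℤ.* + suc d
    le rewrite sym (ℤ.pos-* a (suc e)) | sym (ℤ.pos-* a (suc d)) = ℤ.+≤+ (ℕ.*-monoʳ-≤ a (ℕ.s≤s e≤d))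

  a/d≤1 : ∀ {a d} → a ℕ.≤ suc d → + a / suc d ≤ 1ℚ
  a/d≤1 {a} {d} a≤d = fromℚᵘ-mono-≤ {mkℚᵘ (+ a) d} {ℕ→ℚᵘ 1} (*≤* le)
    where
    le : + a ℤ.* + 1 ℤ.≤ + 1 ℤ.* + suc d
    le rewrite ℤ.*-identityʳ (+ a) | ℤ.*-identityˡ (+ suc d) = ℤ.+≤+ a≤d

  0≤a/d : ∀ a d → 0ℚ ≤ + a / suc d
  0≤a/d a d = fromℚᵘ-mono-≤ {ℕ→ℚᵘ 0} {mkℚᵘ (+ a) d} (*≤* le)
    where
    le : + 0 ℤ.* + suc d ℤ.≤ + a ℤ.* + 1
    le rewrite ℤ.*-identityʳ (+ a) = ℤ.+≤+ ℕ.z≤n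

  0≤toℚ : ∀ a → 0ℚ ≤ toℚ a
  0≤toℚ a = 0≤a/d a 0

  0<toℚ-suc : ∀ d → 0ℚ < toℚ (suc d)
  0<toℚ-suc d = toℚᵘ-cancel-< (ℚᵘ.<-respʳ-≃ (ℚᵘ.≃-sym (toℚᵘ-fromℚᵘ (ℕ→ℚᵘ (suc d)))) (*<* (ℤ.+<+ (ℕ.s≤s ℕ.z≤n))))

  toℚ-∸ : ∀ {m j} → j ℕ.≤ m → toℚ (m ℕ.∸ j) ≡ toℚ m - toℚ j
  toℚ-∸ {m} {j} j≤m = begin
    toℚ (m ℕ.∸ j)                  ≡⟨ solve 2 (λ a b → a := (a :+ b) :- b) refl (toℚ (m ℕ.∸ j)) (toℚ j) ⟩
    (toℚ (m ℕ.∸ j) + toℚ j) - toℚ j ≡⟨ cong (_- toℚ j) (toℚ-+ (m ℕ.∸ j) j) ⟨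
    toℚ (m ℕ.∸ j ℕ.+ j) - toℚ j     ≡⟨ cong (λ x → toℚ x - toℚ j) (ℕ.m∸n+n≡m j≤m) ⟩
    toℚ m - toℚ j                   ∎
    where
    open ≡-Reasoning
    open ℚ-Solver

  *-monoˡ-≤-0≤ : ∀ {r p q} → 0ℚ ≤ r → p ≤ q → r * p ≤ r * q
  *-monoˡ-≤-0≤ {r} 0≤r = *-monoˡ-≤-nonNeg r {{nonNegative 0≤r}}

  *-monoʳ-≤-0≤ : ∀ {r p q} → 0ℚ ≤ r → p ≤ q → p * r ≤ q * r
  *-monoʳ-≤-0≤ {r} 0≤r = *-monoʳ-≤-nonNeg r {{nonNegative 0≤r}}

  *-mono-≤-0≤ : ∀ {p p′ q q′} → 0ℚ ≤ p → 0ℚ ≤ q′ → p ≤ p′ → q ≤ q′ → p * q ≤ p′ * q′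
  *-mono-≤-0≤ 0≤p 0≤q′ p≤p′ q≤q′ = ≤-trans (*-monoˡ-≤-0≤ 0≤p q≤q′) (*-monoʳ-≤-0≤ 0≤q′ p≤p′)

  0≤p*q : ∀ {p q} → 0ℚ ≤ p → 0ℚ ≤ q → 0ℚ ≤ p * q
  0≤p*q {p} 0≤p 0≤q = ≤-trans (≤-reflexive (sym (*-zeroʳ p))) (*-monoˡ-≤-0≤ 0≤p 0≤q)

  p≤q⇒0≤q-p : ∀ {p q} → p ≤ q → 0ℚ ≤ q - p
  p≤q⇒0≤q-p {p} p≤q = ≤-trans (≤-reflexive (sym (+-inverseʳ p))) (+-monoˡ-≤ (- p) p≤q)

  *-cancelʳ-pos : ∀ {p q w} → 0ℚ < w → p * w ≡ q * w → p ≡ q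
  *-cancelʳ-pos {w = w} 0<w eq = ≤-antisym (*-cancelʳ-≤-pos w {{positive 0<w}} (≤-reflexive eq))
                                           (*-cancelʳ-≤-pos w {{positive 0<w}} (≤-reflexive (sym eq)))

  1/suc : ℕ → ℚ
  1/suc k = + 1 / suc k

  1/suc-step : ∀ k → (1ℚ + 1/suc k) * 1/suc (suc k) ≡ 1/suc k
  1/suc-step k = *-cancelʳ-pos (0<toℚ-suc k) (*-cancelʳ-pos (0<toℚ-suc (suc k)) (begin
    (1ℚ + 1/suc k) * 1/suc (suc k) * u * v
      ≡⟨ solve 4 (λ a b u v → (con 1ℚ :+ a) :* b :* u :* v := (u :+ a :* u) :* (b :* v)) refl (1/suc k) (1/suc (suc k)) u v ⟩
    (u + 1/suc k * u) * (1/suc (suc k) * v)    ≡⟨ cong₂ (λ p q → (u + p) * q) (a/d*d≡a 1 k) (a/d*d≡a 1 (suc k)) ⟩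
    (u + 1ℚ) * 1ℚ                               ≡⟨ solve 1 (λ u → (u :+ con 1ℚ) :* con 1ℚ := con 1ℚ :+ u) refl u ⟩
    1ℚ + u                                      ≡⟨ toℚ-+ 1 (suc k) ⟨
    v                                           ≡⟨ *-identityˡ v ⟨
    1ℚ * v                                      ≡⟨ cong (_* v) (a/d*d≡a 1 k) ⟨
    1/suc k * u * v                             ∎))
    where
    open ≡-Reasoning
    open ℚ-Solver
    u = toℚ (suc k)
    v = toℚ (suc (suc k))

  0≤expTerm : ∀ {x} → 0ℚ ≤ x → ∀ k → 0ℚ ≤ expTerm x k
  0≤expTerm 0≤x zero    = 0≤toℚ 1
  0≤expTerm 0≤x (suc k) = 0≤p*q (0≤p*q (0≤expTerm 0≤x k) 0≤x) (0≤a/d 1 k)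

  expTerm-mono-≤ : ∀ {c b} → 0ℚ ≤ c → c ≤ b → ∀ k → expTerm c k ≤ expTerm b k
  expTerm-mono-≤ 0≤c c≤b zero    = ≤-refl
  expTerm-mono-≤ 0≤c c≤b (suc k) =
    *-monoʳ-≤-0≤ (0≤a/d 1 k) (*-mono-≤-0≤ (0≤expTerm 0≤c k) (≤-trans 0≤c c≤b) (expTerm-mono-≤ 0≤c c≤b k) c≤b)

  expTerm-sub-≤ : ∀ {c b} → 0ℚ ≤ c → c ≤ b → ∀ k → expTerm b (suc k) - expTerm c (suc k) ≤ (b - c) * expTerm b k
  expTerm-sub-≤ {c} {b} 0≤c c≤b zero = ≤-reflexive
    (solve 2 (λ b c → con 1ℚ :* b :* con 1ℚ :- con 1ℚ :* c :* con 1ℚ := (b :- c) :* con 1ℚ) refl b c)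
    where open ℚ-Solver
  expTerm-sub-≤ {c} {b} 0≤c c≤b (suc k) = begin
    B₁ * b * t - C₁ * c * t
      ≡⟨ solve 5 (λ B₁ C₁ b c t → B₁ :* b :* t :- C₁ :* c :* t := (b :* (B₁ :- C₁) :+ C₁ :* (b :- c)) :* t) refl B₁ C₁ b c t ⟩
    (b * (B₁ - C₁) + C₁ * (b - c)) * t
      ≤⟨ *-monoʳ-≤-0≤ (0≤a/d 1 (suc k)) (+-mono-≤ (*-monoˡ-≤-0≤ 0≤b (expTerm-sub-≤ 0≤c c≤b k))
                                                  (*-monoʳ-≤-0≤ (p≤q⇒0≤q-p c≤b) (expTerm-mono-≤ 0≤c c≤b (suc k)))) ⟩
    (b * ((b - c) * B₀) + B₁ * (b - c)) * t
      ≡⟨ solve 5 (λ B₀ b c t₀ t → (b :* ((b :- c) :* B₀) :+ (B₀ :* b :* t₀) :* (b :- c)) :* t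
                                := (b :- c) :* (B₀ :* b) :* ((con 1ℚ :+ t₀) :* t)) refl B₀ b c (1/suc k) t ⟩
    (b - c) * (B₀ * b) * ((1ℚ + 1/suc k) * t)    ≡⟨ cong ((b - c) * (B₀ * b) *_) (1/suc-step k) ⟩
    (b - c) * (B₀ * b) * 1/suc k                 ≡⟨ *-assoc (b - c) (B₀ * b) (1/suc k) ⟩
    (b - c) * B₁                                 ∎
    where
    open ≤-Reasoning
    open ℚ-Solver
    B₀ = expTerm b k
    B₁ = expTerm b (suc k)
    C₁ = expTerm c (suc k)
    t = 1/suc (suc k)
    0≤b = ≤-trans 0≤c c≤b

  0≤expPartial : ∀ {x} → 0ℚ ≤ x → ∀ N → 0ℚ ≤ expPartial x N
  0≤expPartial 0≤x zero    = 0≤toℚ 1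
  0≤expPartial 0≤x (suc N) = +-mono-≤ (0≤expPartial 0≤x N) (0≤expTerm 0≤x (suc N))

  expPartial-≤-suc : ∀ {x} → 0ℚ ≤ x → ∀ N → expPartial x N ≤ expPartial x (suc N)
  expPartial-≤-suc {x} 0≤x N =
    ≤-trans (≤-reflexive (sym (+-identityʳ (expPartial x N)))) (+-monoʳ-≤ (expPartial x N) (0≤expTerm 0≤x (suc N)))

  expPartial-suc-sub-≤ : ∀ {c b} → 0ℚ ≤ c → c ≤ b → ∀ N →
    expPartial b (suc N) - expPartial c (suc N) ≤ (b - c) * expPartial b N
  expPartial-suc-sub-≤ {c} {b} 0≤c c≤b zero = begin
    (1ℚ + expTerm b 1) - (1ℚ + expTerm c 1)
      ≡⟨ solve 2 (λ x y → (con 1ℚ :+ x) :- (con 1ℚ :+ y) := x :- y) refl (expTerm b 1) (expTerm c 1) ⟩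
    expTerm b 1 - expTerm c 1
      ≤⟨ expTerm-sub-≤ 0≤c c≤b 0 ⟩
    (b - c) * 1ℚ ∎
    where
    open ≤-Reasoning
    open ℚ-Solver
  expPartial-suc-sub-≤ {c} {b} 0≤c c≤b (suc N) = begin
    (Eb + tb) - (Ec + tc)
      ≡⟨ solve 4 (λ Eb tb Ec tc → (Eb :+ tb) :- (Ec :+ tc) := (Eb :- Ec) :+ (tb :- tc)) refl Eb tb Ec tc ⟩
    (Eb - Ec) + (tb - tc)
      ≤⟨ +-mono-≤ (expPartial-suc-sub-≤ 0≤c c≤b N) (expTerm-sub-≤ 0≤c c≤b (suc N)) ⟩
    (b - c) * expPartial b N + (b - c) * expTerm b (suc N)
      ≡⟨ *-distribˡ-+ (b - c) _ _ ⟨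
    (b - c) * expPartial b (suc N) ∎
    where
    open ≤-Reasoning
    open ℚ-Solver
    Eb = expPartial b (suc N)
    Ec = expPartial c (suc N)
    tb = expTerm b (suc (suc N))
    tc = expTerm c (suc (suc N))

  expPartial-sub-≤ : ∀ {c b} → 0ℚ ≤ c → c ≤ b → ∀ N → expPartial b N - expPartial c N ≤ (b - c) * expPartial b N
  expPartial-sub-≤ {c} {b} 0≤c c≤b zero    = ≤-trans (≤-reflexive (+-inverseʳ 1ℚ)) (0≤p*q (p≤q⇒0≤q-p c≤b) (0≤toℚ 1))
  expPartial-sub-≤ {c} {b} 0≤c c≤b (suc N) =
    ≤-trans (expPartial-suc-sub-≤ 0≤c c≤b N) (*-monoˡ-≤-0≤ (p≤q⇒0≤q-p c≤b) (expPartial-≤-suc (≤-trans 0≤c c≤b) N))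

  expPartial-shift : ∀ {y a} → 0ℚ ≤ y → 0ℚ ≤ a → ∀ N → (1ℚ - a) * expPartial (y + a) N ≤ expPartial y N
  expPartial-shift {y} {a} 0≤y 0≤a N = begin
    (1ℚ - a) * E⁺
      ≡⟨ solve 4 (λ E⁺ E a y → (con 1ℚ :- a) :* E⁺ := E :+ ((E⁺ :- E) :- ((y :+ a) :- y) :* E⁺)) refl E⁺ E a y ⟩
    E + (D - R)
      ≤⟨ +-monoʳ-≤ E (≤-trans (+-monoˡ-≤ (- R) (expPartial-sub-≤ 0≤y y≤y+a N)) (≤-reflexive (+-inverseʳ R))) ⟩
    E + 0ℚ                                       ≡⟨ +-identityʳ E ⟩
    E                                            ∎
    where
    open ≤-Reasoning
    open ℚ-Solver
    E⁺ = expPartial (y + a) N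
    E = expPartial y N
    D = E⁺ - E
    R = ((y + a) - y) * E⁺
    y≤y+a : y ≤ y + a
    y≤y+a = ≤-trans (≤-reflexive (sym (+-identityʳ y))) (+-monoʳ-≤ y 0≤a)

  expPartial-0 : ∀ N → expPartial 0ℚ N ≡ 1ℚ
  expPartial-0 zero    = refl
  expPartial-0 (suc N) = trans (cong₂ _+_ (expPartial-0 N) (expTerm-0 N)) (+-identityʳ 1ℚ)
    where
    expTerm-0 : ∀ k → expTerm 0ℚ (suc k) ≡ 0ℚ
    expTerm-0 k = trans (cong (_* 1/suc k) (*-zeroʳ (expTerm 0ℚ k))) (*-zeroˡ (1/suc k))

  0≤prodTerm : ∀ {r} k → k ℕ.+ k ℕ.≤ r → 0ℚ ≤ prodTerm r k
  0≤prodTerm zero    _    = 0≤toℚ 1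
  0≤prodTerm (suc k) 2k≤r = 0≤p*q (0≤prodTerm k (ℕ.≤-trans (ℕ.+-mono-≤ (ℕ.n≤1+n k) (ℕ.n≤1+n k)) 2k≤r))
                                  (p≤q⇒0≤q-p (a/d≤1 (ℕ.m≤n⇒m≤1+n (ℕ.m+n≤o⇒m≤o∸n (suc k) 2k≤r))))

  module _ (r′ : ℕ) where

    ratio : ℕ → ℚ
    ratio j = + j / suc r′

    ratioProd : ℕ → ℚ
    ratioProd zero    = 1ℚ
    ratioProd (suc k) = ratioProd k * (1ℚ - ratio (suc k))

    ratioSum : ℕ → ℚ
    ratioSum zero    = 0ℚ
    ratioSum (suc k) = ratioSum k + ratio (suc k)

    0≤ratioSum : ∀ k → 0ℚ ≤ ratioSum k
    0≤ratioSum zero    = ≤-refl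
    0≤ratioSum (suc k) = +-mono-≤ (0≤ratioSum k) (0≤a/d (suc k) r′)

    0≤ratioProd : ∀ k → k ℕ.≤ suc r′ → 0ℚ ≤ ratioProd k
    0≤ratioProd zero    _   = 0≤toℚ 1
    0≤ratioProd (suc k) k≤r = 0≤p*q (0≤ratioProd k (ℕ.m≤n⇒m≤1+n (ℕ.≤-pred k≤r))) (p≤q⇒0≤q-p (a/d≤1 k≤r))

    ratioProd*expPartial≤1 : ∀ k → k ℕ.≤ suc r′ → ∀ N → ratioProd k * expPartial (ratioSum k) N ≤ 1ℚ
    ratioProd*expPartial≤1 zero    _   N = ≤-reflexive (trans (cong (1ℚ *_) (expPartial-0 N)) (*-identityˡ 1ℚ))
    ratioProd*expPartial≤1 (suc k) k≤r N = begin
      ratioProd k * (1ℚ - ratio (suc k)) * expPartial (ratioSum k + ratio (suc k)) N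
        ≡⟨ *-assoc (ratioProd k) _ _ ⟩
      ratioProd k * ((1ℚ - ratio (suc k)) * expPartial (ratioSum k + ratio (suc k)) N)
        ≤⟨ *-monoˡ-≤-0≤ (0≤ratioProd k k≤r′) (expPartial-shift (0≤ratioSum k) (0≤a/d (suc k) r′) N) ⟩
      ratioProd k * expPartial (ratioSum k) N
        ≤⟨ ratioProd*expPartial≤1 k k≤r′ N ⟩
      1ℚ ∎
      where
      open ≤-Reasoning
      k≤r′ = ℕ.m≤n⇒m≤1+n (ℕ.≤-pred k≤r)

    ratioSum*2r≡k[k+1] : ∀ k → ratioSum k * toℚ (2 ℕ.* suc r′) ≡ toℚ (k ℕ.* suc k)
    ratioSum*2r≡k[k+1] zero    = *-zeroˡ (toℚ (2 ℕ.* suc r′))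
    ratioSum*2r≡k[k+1] (suc k) = begin
      (ratioSum k + ratio (suc k)) * 2r
        ≡⟨ *-distribʳ-+ 2r (ratioSum k) (ratio (suc k)) ⟩
      ratioSum k * 2r + ratio (suc k) * 2r
        ≡⟨ cong₂ _+_ (ratioSum*2r≡k[k+1] k) (cong (ratio (suc k) *_) 2r≡r*2) ⟩
      toℚ (k ℕ.* suc k) + ratio (suc k) * (toℚ (suc r′) * toℚ 2)
        ≡⟨ cong (λ z → toℚ (k ℕ.* suc k) + z) (*-assoc (ratio (suc k)) _ _) ⟨
      toℚ (k ℕ.* suc k) + ratio (suc k) * toℚ (suc r′) * toℚ 2
        ≡⟨ cong (λ z → toℚ (k ℕ.* suc k) + z * toℚ 2) (a/d*d≡a (suc k) r′) ⟩
      toℚ (k ℕ.* suc k) + toℚ (suc k) * toℚ 2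
        ≡⟨ cong (λ z → toℚ (k ℕ.* suc k) + z) (toℚ-* (suc k) 2) ⟨
      toℚ (k ℕ.* suc k) + toℚ (suc k ℕ.* 2)
        ≡⟨ toℚ-+ (k ℕ.* suc k) (suc k ℕ.* 2) ⟨
      toℚ (k ℕ.* suc k ℕ.+ suc k ℕ.* 2)
        ≡⟨ cong toℚ (solve 1 (λ k → k :* (con 1 :+ k) :+ (con 1 :+ k) :* con 2 := (con 1 :+ k) :* (con 2 :+ k)) refl k) ⟩
      toℚ (suc k ℕ.* suc (suc k)) ∎
      where
      open ≡-Reasoning
      open ℕ-Solver
      2r = toℚ (2 ℕ.* suc r′)
      2r≡r*2 : 2r ≡ toℚ (suc r′) * toℚ 2
      2r≡r*2 = trans (cong toℚ (ℕ.*-comm 2 (suc r′))) (toℚ-* (suc r′) 2)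

    expo≡ratioSum : ∀ s → expo s (suc r′) ≡ ratioSum s
    expo≡ratioSum s = *-cancelʳ-pos (0<toℚ-suc (r′ ℕ.+ 1 ℕ.* suc r′))
      (trans (a/d*d≡a (s ℕ.* suc s) (r′ ℕ.+ 1 ℕ.* suc r′)) (sym (ratioSum*2r≡k[k+1] s)))

    prodTerm≤ratioProd : ∀ k → k ℕ.+ k ℕ.≤ suc r′ → prodTerm (suc r′) k ≤ ratioProd k
    prodTerm≤ratioProd zero    _    = ≤-refl
    prodTerm≤ratioProd (suc k) 2k≤r =
      *-mono-≤-0≤ (0≤prodTerm k 2k≤r′) (p≤q⇒0≤q-p (a/d≤1 (ℕ.m+n≤o⇒m≤o (suc k) 2k≤r))) (prodTerm≤ratioProd k 2k≤r′) factor≤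
      where
      2k≤r′ = ℕ.≤-trans (ℕ.+-mono-≤ (ℕ.n≤1+n k) (ℕ.n≤1+n k)) 2k≤r
      factor≤ : 1ℚ - + suc k / suc (r′ ∸ k) ≤ 1ℚ - ratio (suc k)
      factor≤ = +-monoʳ-≤ 1ℚ (neg-antimono-≤ (a/d-antimono-≤ (suc k) (ℕ.m∸n≤m r′ k)))

  prodTerm*expPartial≤1 : ∀ r′ s → s ℕ.+ s ℕ.≤ suc r′ → ∀ N → prodTerm (suc r′) s * expPartial (expo s (suc r′)) N ≤ 1ℚ
  prodTerm*expPartial≤1 r′ s 2s≤r N = begin
    prodTerm (suc r′) s * expPartial (expo s (suc r′)) N
      ≡⟨ cong (λ x → prodTerm (suc r′) s * expPartial x N) (expo≡ratioSum r′ s) ⟩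
    prodTerm (suc r′) s * expPartial (ratioSum r′ s) N
      ≤⟨ *-monoʳ-≤-0≤ (0≤expPartial (0≤ratioSum r′ s) N) (prodTerm≤ratioProd r′ s 2s≤r) ⟩
    ratioProd r′ s * expPartial (ratioSum r′ s) N
      ≤⟨ ratioProd*expPartial≤1 r′ s (ℕ.m+n≤o⇒m≤o s 2s≤r) N ⟩
    1ℚ ∎
    where open ≤-Reasoning

  prodTerm*prodDen≡prodNum : ∀ {r} k → k ℕ.+ k ℕ.≤ r → prodTerm r k * toℚ (prodDen r k) ≡ toℚ (prodNum r k)
  prodTerm*prodDen≡prodNum zero    _    = refl
  prodTerm*prodDen≡prodNum {r} (suc k) 2k≤r = begin
    (P * f) * toℚ (prodDen r k ℕ.* d)
      ≡⟨ cong ((P * f) *_) (toℚ-* (prodDen r k) d) ⟩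
    (P * f) * (toℚ (prodDen r k) * toℚ d)
      ≡⟨ solve 4 (λ P f a b → (P :* f) :* (a :* b) := (P :* a) :* (f :* b)) refl P f (toℚ (prodDen r k)) (toℚ d) ⟩
    (P * toℚ (prodDen r k)) * (f * toℚ d)
      ≡⟨ cong₂ _*_ (prodTerm*prodDen≡prodNum k 2k≤r′) f*d≡d∸j ⟩
    toℚ (prodNum r k) * toℚ (d ∸ suc k)
      ≡⟨ toℚ-* (prodNum r k) (d ∸ suc k) ⟨
    toℚ (prodNum r k ℕ.* (d ∸ suc k)) ∎
    where
    open ≡-Reasoning
    open ℚ-Solver
    P = prodTerm r k
    d = suc (r ∸ suc k)
    j/d = + suc k / d
    f = 1ℚ - j/d
    2k≤r′ : k ℕ.+ k ℕ.≤ r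
    2k≤r′ = ℕ.≤-trans (ℕ.+-mono-≤ (ℕ.n≤1+n k) (ℕ.n≤1+n k)) 2k≤r
    j≤d : suc k ℕ.≤ d
    j≤d = ℕ.m≤n⇒m≤1+n (ℕ.m+n≤o⇒m≤o∸n (suc k) 2k≤r)
    f*d≡d∸j : f * toℚ d ≡ toℚ (d ∸ suc k)
    f*d≡d∸j = begin
      (1ℚ - j/d) * toℚ d         ≡⟨ solve 2 (λ a t → (con 1ℚ :- a) :* t := t :- a :* t) refl j/d (toℚ d) ⟩
      toℚ d - j/d * toℚ d        ≡⟨ cong (λ x → toℚ d - x) (a/d*d≡a (suc k) (r ∸ suc k)) ⟩
      toℚ d - toℚ (suc k)         ≡⟨ toℚ-∸ j≤d ⟨
      toℚ (d ∸ suc k)              ∎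

  n*D≤[n∸⌊nN/D⌋]*D+n*N : ∀ n N D .{{_ : NonZero D}} → n ℕ.* D ℕ.≤ (n ∸ (n ℕ.* N) ℕ./ D) ℕ.* D ℕ.+ n ℕ.* N
  n*D≤[n∸⌊nN/D⌋]*D+n*N n N D = begin
    n ℕ.* D                          ≤⟨ ℕ.*-monoˡ-≤ D (ℕ.m≤n+m∸n n q) ⟩
    (q ℕ.+ (n ∸ q)) ℕ.* D            ≡⟨ ℕ.*-distribʳ-+ D q (n ∸ q) ⟩
    q ℕ.* D ℕ.+ (n ∸ q) ℕ.* D        ≤⟨ ℕ.+-monoˡ-≤ ((n ∸ q) ℕ.* D) (m/n*n≤m (n ℕ.* N) D) ⟩
    n ℕ.* N ℕ.+ (n ∸ q) ℕ.* D        ≡⟨ ℕ.+-comm (n ℕ.* N) ((n ∸ q) ℕ.* D) ⟩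
    (n ∸ q) ℕ.* D ℕ.+ n ℕ.* N        ∎
    where
    open ℕ.≤-Reasoning
    q = (n ℕ.* N) ℕ./ D

  n-nP≤n∸⌊nN/D⌋ : ∀ n N D .{{_ : NonZero D}} {P} → P * toℚ D ≡ toℚ N → toℚ n - toℚ n * P ≤ toℚ (n ∸ (n ℕ.* N) ℕ./ D)
  n-nP≤n∸⌊nN/D⌋ n N D@(suc d) {P} P*D≡N = *-cancelʳ-≤-pos (toℚ D) {{positive (0<toℚ-suc d)}} (begin
    (toℚ n - toℚ n * P) * toℚ D
      ≡⟨ solve 3 (λ a p d → (a :- a :* p) :* d := a :* d :- a :* (p :* d)) refl (toℚ n) P (toℚ D) ⟩
    toℚ n * toℚ D - toℚ n * (P * toℚ D)
      ≡⟨ cong₂ (λ x y → x - toℚ n * y) (sym (toℚ-* n D)) P*D≡N ⟩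
    toℚ (n ℕ.* D) - toℚ n * toℚ N
      ≡⟨ cong (λ x → toℚ (n ℕ.* D) - x) (toℚ-* n N) ⟨
    toℚ (n ℕ.* D) - toℚ (n ℕ.* N)
      ≤⟨ +-monoˡ-≤ (- toℚ (n ℕ.* N)) (toℚ-mono-≤ (n*D≤[n∸⌊nN/D⌋]*D+n*N n N D)) ⟩
    toℚ ((n ∸ q) ℕ.* D ℕ.+ n ℕ.* N) - toℚ (n ℕ.* N)
      ≡⟨ toℚ-∸ (ℕ.m≤n+m (n ℕ.* N) ((n ∸ q) ℕ.* D)) ⟨
    toℚ ((n ∸ q) ℕ.* D ℕ.+ n ℕ.* N ∸ n ℕ.* N)
      ≡⟨ cong toℚ (ℕ.m+n∸n≡m ((n ∸ q) ℕ.* D) (n ℕ.* N)) ⟩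
    toℚ ((n ∸ q) ℕ.* D)
      ≡⟨ toℚ-* (n ∸ q) D ⟩
    toℚ (n ∸ q) * toℚ D ∎)
    where
    open ≤-Reasoning
    open ℚ-Solver
    q = (n ℕ.* N) ℕ./ D

  n-n*prodTerm≤guaranteed : ∀ n r s → s ℕ.+ s ℕ.≤ r → toℚ n - toℚ n * prodTerm r s ≤ toℚ (guaranteed n r s)
  n-n*prodTerm≤guaranteed n r s 2s≤r =
    n-nP≤n∸⌊nN/D⌋ n (prodNum r s) (prodDen r s) {{prodDen-nonZero r s}} (prodTerm*prodDen≡prodNum s 2s≤r)

open Colourings using (guaranteed; good-guaranteed)
open RationalBounds using (toℚ-mono-≤; prodTerm*expPartial≤1; n-n*prodTerm≤guaranteed)
open import Data.Nat using (ℕ; suc; _+_; _*_; _≤_)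
open import Data.Nat.Properties using (+-identityʳ; m+n≤o⇒m≤o)
open import Data.Rational using (1ℚ) renaming (_*_ to _*ℚ_; _-_ to _-ℚ_; _≤_ to _≤ℚ_)
open import Data.Rational.Properties using (≤-trans)
open import Data.Product using (_×_; _,_)
open import Relation.Binary.PropositionalEquality using (cong; subst)

proposition3p6 : ∀ (n r s : ℕ) → 1 ≤ n → 1 ≤ r → 1 ≤ s → 2 * s ≤ r →
    (∀ m → IsF n r s m →
      (toℚ n -ℚ toℚ n *ℚ prodTerm r s) ≤ℚ toℚ m)
    × (∀ N → prodTerm r s *ℚ expPartial (expo s r) N ≤ℚ 1ℚ)
proposition3p6 n r@(suc r′) s _ _ _ 2s≤r = lower-bound , prodTerm*expPartial≤1 r′ s s+s≤r
  where
  s+s≤r : s + s ≤ r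
  s+s≤r = subst (_≤ r) (cong (s +_) (+-identityʳ s)) 2s≤r
  lower-bound : ∀ m → IsF n r s m → toℚ n -ℚ toℚ n *ℚ prodTerm r s ≤ℚ toℚ m
  lower-bound m (_ , maximal) = ≤-trans
    (n-n*prodTerm≤guaranteed n r s s+s≤r)
    (toℚ-mono-≤ (maximal (guaranteed n r s) (good-guaranteed n r s (m+n≤o⇒m≤o s s+s≤r))))
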